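{- Let $A$ be a set of at most $n$ coins containing at most $m$ counterfeit coins, where $1\le m\leq n$. Then, with probability $1-e^{ -\Omega(m)}$, the randomized binary search finds all counterfeit coins in $A$ using at most $(\lceil\log n\rceil+3)m$ queries.
   Context: Authentic coins have weight $0$ and counterfeit coins have nonzero real weights; a query consists of choosing a set of coins and receiving the sum of their weights. The randomized binary search repeats the following round on the set of coins not yet identified as counterfeit: select each such coin independently with probability $1/2$ and weigh the set $A'$ of selected coins; if the weight is nonzero, run the deterministic binary search on $A'$ and record the counterfeit coin it returns (which is then no longer considered). The deterministic binary search on a set $A'$ of nonzero weight divides $A'$ into two parts $A'_1,A'_2$ whose sizes differ by at most $1$, weighs $A'_1$, continues with $A'_1$ if $w(A'_1)\neq 0$ and with $A'_2$ otherwise, and repeats until a single coin (necessarily counterfeit) remains. Logarithms are base $2$. -}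

module Defs where

open import Data.Bool using (Bool; true; false; not; _∨_; if_then_else_)
open import Data.Nat using (ℕ; zero; suc; _+_; _*_; _^_; _≤_; _≤ᵇ_)
open import Data.Fin using (Fin)
open import Data.List using (List; []; _∷_; length; filterᵇ; allFin; foldr; concatMap; map; _++_)
open import Data.Bool.ListAction using (and)
open import Data.List.Relation.Binary.Permutation.Propositional using (_↭_)
open import Data.Vec using (Vec; []; _∷_; lookup; replicate; _[_]≔_)
open import Data.Maybe using (Maybe; just; nothing)
open import Data.Product using (_×_; _,_; proj₁; proj₂)
open import Data.Rational using (ℚ; 0ℚ) renaming (_+_ to _+ℚ_)
open import Data.Rational.Properties using (_≟_)
open import Relation.Nullary using (does)

-- A subset of the k coins (Fin k): true = member.
Subset : ℕ → Set
Subset k = Vec Bool k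

allSubsets : (k : ℕ) → List (Subset k)
allSubsets zero = [] ∷ []
allSubsets (suc k) = concatMap (λ s → (true ∷ s) ∷ (false ∷ s) ∷ []) (allSubsets k)

-- all sequences of B subsets (the sample space for B rounds; uniform measure)
allSeqs : (k B : ℕ) → List (Vec (Subset k) B)
allSeqs k zero = [] ∷ []
allSeqs k (suc B) = concatMap (λ r → map (r ∷_) (allSeqs k B)) (allSubsets k)

members : {k : ℕ} → Subset k → List (Fin k)
members {k} s = filterᵇ (lookup s) (allFin k)

intersect : {k : ℕ} → Subset k → Subset k → Subset k
intersect [] [] = []
intersect (a ∷ s) (b ∷ t) = (if a then b else false) ∷ intersect s t

isZero : ℚ → Bool
isZero q = does (q ≟ 0ℚ)

-- weight of a set of coins = sum of the weights (the query answer)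
weight : {k : ℕ} → (Fin k → ℚ) → List (Fin k) → ℚ
weight w = foldr (λ i acc → w i +ℚ acc) 0ℚ

Splitter : ℕ → Set
Splitter k = List (Fin k) → List (Fin k) × List (Fin k)

ValidSplitter : {k : ℕ} → Splitter k → Set
ValidSplitter {k} sp = (l : List (Fin k)) → 2 ≤ length l →
  (proj₁ (sp l) ++ proj₂ (sp l)) ↭ l ×
  length (proj₁ (sp l)) ≤ suc (length (proj₂ (sp l))) ×
  length (proj₂ (sp l)) ≤ suc (length (proj₁ (sp l)))

-- deterministic binary search (with fuel; fuel = length suffices for valid splitters).
-- returns the coin found and the number of queries made.
binSearch : {k : ℕ} → Splitter k → (Fin k → ℚ) → ℕ → List (Fin k) → Maybe (Fin k × ℕ)
binSearch sp w zero l = nothing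
binSearch sp w (suc f) [] = nothing
binSearch sp w (suc f) (x ∷ []) = just (x , 0)
binSearch sp w (suc f) l@(x ∷ y ∷ rest) with binSearch sp w f (proj₁ (sp l)) | binSearch sp w f (proj₂ (sp l))
... | r₁ | r₂ = step (isZero (weight w (proj₁ (sp l))))
  where
  plus1 : Maybe (Fin _ × ℕ) → Maybe (Fin _ × ℕ)
  plus1 nothing = nothing
  plus1 (just (i , q)) = just (i , suc q)
  step : Bool → Maybe (Fin _ × ℕ)
  step false = plus1 r₁
  step true  = plus1 r₂

allFound : {k : ℕ} → (Fin k → ℚ) → Subset k → Bool
allFound {k} w rem = and (map (λ i → isZero (w i) ∨ not (lookup rem i)) (allFin k))

-- randomized binary search, driven by the given random subsets (one per round).
-- `rem` = coins not yet identified as counterfeit, `q` = queries used so far.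
-- Returns just (total number of queries used at the moment all counterfeit
-- coins have been identified), or nothing if the given rounds do not suffice.
runRBS : {k B : ℕ} → Splitter k → (Fin k → ℚ) → Vec (Subset k) B → Subset k → ℕ → Maybe ℕ
runRBS sp w rs rem q with allFound w rem
runRBS sp w rs rem q | true = just q
runRBS sp w [] rem q | false = nothing
runRBS sp w (r ∷ rs) rem q | false with members (intersect r rem)
... | A' with isZero (weight w A')
... | true = runRBS sp w rs rem (suc q)
... | false with binSearch sp w (length A') A'
...   | nothing = nothing
...   | just (i , q') = runRBS sp w rs (rem [ i ]≔ false) (suc (q + q'))

-- success: all counterfeit coins found using at most `budget` queries.
-- (Each round uses ≥ 1 query, so `budget` rounds of randomness suffice.)
succeeds : {k : ℕ} → Splitter k → (Fin k → ℚ) → (budget : ℕ) → Vec (Subset k) budget → Bool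
succeeds sp w budget rs with runRBS sp w rs (replicate _ true) 0
... | nothing = false
... | just t = t ≤ᵇ budget

-- number of outcomes (out of 2^(k·budget) equally likely) on which the search fails
failures : {k : ℕ} → Splitter k → (Fin k → ℚ) → ℕ → ℕ
failures {k} sp w budget = length (filterᵇ (λ rs → not (succeeds sp w budget rs)) (allSeqs k budget))

numCounterfeit : {k : ℕ} → (Fin k → ℚ) → ℕ
numCounterfeit {k} w = length (filterᵇ (λ i → not (isZero (w i))) (allFin k))

-- Let d counterfeit coins be still unidentified, q queries spent and R rounds of
-- randomness left.  Whenever q + N + d·L fits in the budget (L ≥ ⌈log₂ k⌉ bounds
-- the cost of one binary search) and N ≤ R, the search fails with probability at
-- most 2^d (3/4)^N.  Induction on N: while a counterfeit coin remains, the weight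
-- of the random subset is a nonzero affine form in its indicator vector, which
-- vanishes on at most half of the cube {0,1}^k (toggling the counterfeit coin
-- changes the weight).  So with probability p ≤ 1/2 the round is empty, and
-- otherwise the binary search removes a counterfeit coin at cost ≤ L + 1; the new
-- bound p·2^d + (1 - p)·2^(d-1) ≤ (3/4)·2^d follows.  With N = 3m and d ≤ m the
-- failure probability is at most 2^m (27/64)^m = (54/64)^m.

{-# OPTIONS --safe #-}
module Submission where

open import Defs
open import Data.Bool using (Bool; true; false; not; _∧_; _∨_; if_then_else_; T)
open import Data.Bool.ListAction using (and)
open import Data.Bool.Properties using (T-≡)
open import Data.Empty using (⊥-elim)
open import Data.Fin using (Fin; zero; suc)
open import Data.List using (List; []; _∷_; foldr; length; filterᵇ; allFin; concatMap; map; _++_)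
open import Data.List.Properties
  using (length-filter; filter-++; filter-≐; length-++; map-cong; map-tabulate; length-tabulate; foldr-map)
open import Data.List.Membership.Propositional using (_∈_)
open import Data.List.Membership.Propositional.Properties using (∈-++⁺ˡ; ∈-++⁺ʳ; ∈-filter⁻)
open import Data.List.Relation.Binary.Permutation.Propositional using (_↭_; ↭⇒↭ₛ′)
open import Data.List.Relation.Binary.Permutation.Propositional.Properties using (map⁺; ↭-length; ∈-resp-↭)
open import Data.List.Relation.Unary.Any using (here)
open import Data.Maybe using (Maybe; just; nothing)
open import Data.Nat using (ℕ; zero; suc; _+_; _∸_; _*_; _^_; _≤_; _<_; _≤ᵇ_; z≤n; s≤s; z<s; ⌈_/2⌉)
open import Data.Nat.ListAction using (sum)
open import Data.Nat.Logarithm using (⌈log₂_⌉; ⌈log₂⌉-mono-≤; ⌈log₂⌈n/2⌉⌉≡⌈log₂n⌉∸1)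
open import Data.Nat.Properties
open import Data.Nat.Tactic.RingSolver using (solve-∀)
open import Data.Product using (Σ; _×_; _,_; proj₁; proj₂)
open import Data.Rational using (ℚ; 0ℚ) renaming (_+_ to _+ℚ_)
import Data.Rational.Properties as QP
open import Data.Vec using (Vec; []; _∷_; lookup; replicate; _[_]≔_)
open import Data.Vec.Properties using (lookup-replicate)
open import Function using (_∘_; id)
open import Function.Bundles using (Equivalence)
open import Relation.Binary.PropositionalEquality
  using (_≡_; _≢_; refl; sym; trans; cong; cong₂; subst; setoid; isEquivalence; module ≡-Reasoning)
open import Relation.Nullary using (T?; yes; no)

open import Algebra.Properties.Group QP.+-0-group using (∙-cancelˡ; ∙-cancelʳ)
import Data.List.Relation.Binary.Permutation.Setoid.Properties (setoid ℚ) as ↭ₛ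

count : {A : Set} → (A → Bool) → List A → ℕ
count p xs = length (filterᵇ p xs)

module _ {A : Set} where

  count≤length : (p : A → Bool) (xs : List A) → count p xs ≤ length xs
  count≤length p = length-filter (T? ∘ p)

  count-++ : (p : A → Bool) (xs ys : List A) → count p (xs ++ ys) ≡ count p xs + count p ys
  count-++ p xs ys = trans (cong length (filter-++ (T? ∘ p) xs ys)) (length-++ (filterᵇ p xs))

  count-cong : {p q : A → Bool} → (∀ x → p x ≡ q x) → (xs : List A) → count p xs ≡ count q xs
  count-cong {p} {q} p≗q xs =
    cong length (filter-≐ (T? ∘ p) (T? ∘ q) ((λ {x} → subst T (p≗q x)) , (λ {x} → subst T (sym (p≗q x)))) xs)

  count-∷ : (p : A → Bool) (x : A) (xs : List A) → count p (x ∷ xs) ≡ (if p x then 1 else 0) + count p xs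
  count-∷ p x xs with p x
  ... | true  = refl
  ... | false = refl

  count-true : (xs : List A) → count (λ _ → true) xs ≡ length xs
  count-true [] = refl
  count-true (x ∷ xs) = cong suc (count-true xs)

  count-false : (xs : List A) → count (λ _ → false) xs ≡ 0
  count-false [] = refl
  count-false (x ∷ xs) = count-false xs

  count-disjoint : (p q : A → Bool) → (∀ x → p x ∧ q x ≡ false) →
    (xs : List A) → count p xs + count q xs ≤ length xs
  count-disjoint p q disj [] = z≤n
  count-disjoint p q disj (x ∷ xs) with ih ← count-disjoint p q disj xs | p x | q x | disj x
  ... | true  | false | _ = s≤s ih
  ... | false | true  | _ = ≤-trans (≤-reflexive (+-suc (count p xs) (count q xs))) (s≤s ih)
  ... | false | false | _ = m≤n⇒m≤1+n ih

  count-suc⇒witness : (p : A → Bool) (xs : List A) {n : ℕ} → count p xs ≡ suc n → Σ A λ x → p x ≡ true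
  count-suc⇒witness p (x ∷ xs) eq with p x in px
  ... | true  = x , px
  ... | false = count-suc⇒witness p xs eq

  count≡0⇒and-not : (p : A → Bool) (xs : List A) → count p xs ≡ 0 → and (map (not ∘ p) xs) ≡ true
  count≡0⇒and-not p [] eq = refl
  count≡0⇒and-not p (x ∷ xs) eq with p x
  ... | false = count≡0⇒and-not p xs eq

  count-suc⇒and-not : (p : A → Bool) (xs : List A) {n : ℕ} → count p xs ≡ suc n → and (map (not ∘ p) xs) ≡ false
  count-suc⇒and-not p (x ∷ xs) eq with p x
  ... | true  = refl
  ... | false = count-suc⇒and-not p xs eq

  sum-map-const : (c : ℕ) (xs : List A) → sum (map (λ _ → c) xs) ≡ length xs * c
  sum-map-const c [] = refl
  sum-map-const c (x ∷ xs) = cong (c +_) (sum-map-const c xs)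

module _ {A B : Set} where

  count-map : (p : B → Bool) (f : A → B) (xs : List A) → count p (map f xs) ≡ count (p ∘ f) xs
  count-map p f [] = refl
  count-map p f (x ∷ xs) with ih ← count-map p f xs | p (f x)
  ... | true  = cong suc ih
  ... | false = ih

  count-concatMap : (p : B → Bool) (f : A → List B) (xs : List A) →
    count p (concatMap f xs) ≡ sum (map (count p ∘ f) xs)
  count-concatMap p f [] = refl
  count-concatMap p f (x ∷ xs) =
    trans (count-++ p (f x) (concatMap f xs)) (cong (count p (f x) +_) (count-concatMap p f xs))

  count-concatMap-pair : (p : B → Bool) (f g : A → B) (xs : List A) →
    count p (concatMap (λ x → f x ∷ g x ∷ []) xs) ≡ count (p ∘ f) xs + count (p ∘ g) xs
  count-concatMap-pair p f g [] = refl
  count-concatMap-pair p f g (x ∷ xs) with ih ← count-concatMap-pair p f g xs | p (f x)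
  ... | true  with p (g x)
  ...   | true  = cong suc (trans (cong suc ih) (sym (+-suc _ _)))
  ...   | false = cong suc ih
  count-concatMap-pair p f g (x ∷ xs) | false with p (g x)
  ...   | true  = trans (cong suc ih) (sym (+-suc _ _))
  ...   | false = ih

module _ {A : Set} (f : A → ℕ) (z : A → Bool) {c X : ℕ} (f≤ : ∀ x → f x * c ≤ (if z x then 2 * X else X)) where

  sum-map-≤ : (xs : List A) → sum (map f xs) * c ≤ X * (length xs + count z xs)
  sum-map-≤ [] = z≤n
  sum-map-≤ (x ∷ xs) with z x | f≤ x
  ... | true  | fx≤ = ≤-trans (≤-reflexive (*-distribʳ-+ c (f x) _)) (≤-trans (+-mono-≤ fx≤ (sum-map-≤ xs))
                        (≤-reflexive (double X (length xs) (count z xs))))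
    where
    double : ∀ X n m → 2 * X + X * (n + m) ≡ X * (suc n + suc m)
    double = solve-∀
  ... | false | fx≤ = ≤-trans (≤-reflexive (*-distribʳ-+ c (f x) _)) (≤-trans (+-mono-≤ fx≤ (sum-map-≤ xs))
                        (≤-reflexive (sym (*-suc X _))))

  averaging : (xs : List A) → count z xs * 2 ≤ length xs → 2 * (sum (map f xs) * c) ≤ 3 * (X * length xs)
  averaging xs few = begin
    2 * (sum (map f xs) * c)                    ≤⟨ *-monoʳ-≤ 2 (sum-map-≤ xs) ⟩
    2 * (X * (length xs + count z xs))          ≡⟨ rearrange X (length xs) (count z xs) ⟩
    2 * (X * length xs) + X * (count z xs * 2)  ≤⟨ +-monoʳ-≤ (2 * (X * length xs)) (*-monoʳ-≤ X few) ⟩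
    2 * (X * length xs) + X * length xs         ≡⟨ +-comm (2 * (X * length xs)) _ ⟩
    3 * (X * length xs)                         ∎
    where
    open ≤-Reasoning
    rearrange : ∀ X n m → 2 * (X * (n + m)) ≡ 2 * (X * n) + X * (m * 2)
    rearrange = solve-∀

^-distrib-* : ∀ a b m → (a * b) ^ m ≡ a ^ m * b ^ m
^-distrib-* a b zero    = refl
^-distrib-* a b (suc m) = trans (cong (a * b *_) (^-distrib-* a b m)) (interchange a b (a ^ m) (b ^ m))
  where
  interchange : ∀ a b x y → a * b * (x * y) ≡ a * x * (b * y)
  interchange = solve-∀

allFin-suc : (k : ℕ) → allFin (suc k) ≡ zero ∷ map suc (allFin k)
allFin-suc k = cong (zero ∷_) (sym (map-tabulate {n = k} id suc))

count-allFin-suc : {k : ℕ} (p : Fin (suc k) → Bool) →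
  count p (allFin (suc k)) ≡ (if p zero then 1 else 0) + count (p ∘ suc) (allFin k)
count-allFin-suc {k} p =
  trans (cong (count p) (allFin-suc k))
        (trans (count-∷ p zero _) (cong ((if p zero then 1 else 0) +_) (count-map p suc (allFin k))))

count-allSubsets-suc : (k : ℕ) (p : Subset (suc k) → Bool) →
  count p (allSubsets (suc k)) ≡ count (p ∘ (true ∷_)) (allSubsets k) + count (p ∘ (false ∷_)) (allSubsets k)
count-allSubsets-suc k p = count-concatMap-pair p (true ∷_) (false ∷_) (allSubsets k)

length-allSubsets : (k : ℕ) → length (allSubsets k) ≡ 2 ^ k
length-allSubsets zero = refl
length-allSubsets (suc k) = begin
  length (allSubsets (suc k))                 ≡⟨ sym (count-true (allSubsets (suc k))) ⟩
  count (λ _ → true) (allSubsets (suc k))     ≡⟨ count-allSubsets-suc k (λ _ → true) ⟩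
  count (λ _ → true) (allSubsets k) + count (λ _ → true) (allSubsets k)
    ≡⟨ cong₂ _+_ (twice) (twice) ⟩
  2 ^ k + 2 ^ k                               ≡⟨ cong (2 ^ k +_) (sym (+-identityʳ (2 ^ k))) ⟩
  2 ^ suc k                                   ∎
  where
  open ≡-Reasoning
  twice : count (λ _ → true) (allSubsets k) ≡ 2 ^ k
  twice = trans (count-true (allSubsets k)) (length-allSubsets k)

count-allSeqs-suc : (k R : ℕ) (p : Vec (Subset k) (suc R) → Bool) →
  count p (allSeqs k (suc R)) ≡ sum (map (λ r → count (p ∘ (r ∷_)) (allSeqs k R)) (allSubsets k))
count-allSeqs-suc k R p =
  trans (count-concatMap p (λ r → map (r ∷_) (allSeqs k R)) (allSubsets k))
        (cong sum (map-cong (λ r → count-map p (r ∷_) (allSeqs k R)) (allSubsets k)))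

length-allSeqs : (k R : ℕ) → length (allSeqs k R) ≡ 2 ^ (k * R)
length-allSeqs k zero = cong (2 ^_) (sym (*-zeroʳ k))
length-allSeqs k (suc R) = begin
  length (allSeqs k (suc R))                       ≡⟨ sym (count-true (allSeqs k (suc R))) ⟩
  count (λ _ → true) (allSeqs k (suc R))           ≡⟨ count-allSeqs-suc k R (λ _ → true) ⟩
  sum (map (λ _ → count (λ _ → true) (allSeqs k R)) (allSubsets k))
    ≡⟨ sum-map-const _ (allSubsets k) ⟩
  length (allSubsets k) * count (λ _ → true) (allSeqs k R)
    ≡⟨ cong₂ _*_ (length-allSubsets k) (trans (count-true (allSeqs k R)) (length-allSeqs k R)) ⟩
  2 ^ k * 2 ^ (k * R)                              ≡⟨ sym (^-distribˡ-+-* 2 k (k * R)) ⟩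
  2 ^ (k + k * R)                                  ≡⟨ cong (2 ^_) (sym (*-suc k R)) ⟩
  2 ^ (k * suc R)                                  ∎
  where open ≡-Reasoning

isZero⇒≡0 : {x : ℚ} → isZero x ≡ true → x ≡ 0ℚ
isZero⇒≡0 {x} eq with x QP.≟ 0ℚ | eq
... | yes x≡0 | _ = x≡0
... | no _    | ()

isZero≡false⇒≢0 : {x : ℚ} → isZero x ≡ false → x ≢ 0ℚ
isZero≡false⇒≢0 () refl

atMostOneZero : (c a b x : ℚ) → a ≢ b → isZero (c +ℚ (a +ℚ x)) ∧ isZero (c +ℚ (b +ℚ x)) ≡ false
atMostOneZero c a b x a≢b with isZero (c +ℚ (a +ℚ x)) in za | isZero (c +ℚ (b +ℚ x)) in zb
... | true  | true  = ⊥-elim (a≢b (∙-cancelʳ x a b (∙-cancelˡ c (a +ℚ x) (b +ℚ x)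
                        (trans (isZero⇒≡0 za) (sym (isZero⇒≡0 zb))))))
... | true  | false = refl
... | false | _     = refl

module _ {k : ℕ} where

  weight-++ : (w : Fin k → ℚ) (xs ys : List (Fin k)) → weight w (xs ++ ys) ≡ weight w xs +ℚ weight w ys
  weight-++ w [] ys = sym (QP.+-identityˡ (weight w ys))
  weight-++ w (x ∷ xs) ys = trans (cong (w x +ℚ_) (weight-++ w xs ys)) (sym (QP.+-assoc (w x) _ _))

  weight-↭ : (w : Fin k → ℚ) {xs ys : List (Fin k)} → xs ↭ ys → weight w xs ≡ weight w ys
  weight-↭ w {xs} {ys} xs↭ys = begin
    weight w xs              ≡⟨ sym (foldr-map _+ℚ_ w 0ℚ xs) ⟩
    foldr _+ℚ_ 0ℚ (map w xs)
      ≡⟨ ↭ₛ.foldr-commMonoid QP.+-0-isCommutativeMonoid (↭⇒↭ₛ′ isEquivalence (map⁺ w xs↭ys)) ⟩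
    foldr _+ℚ_ 0ℚ (map w ys)  ≡⟨ foldr-map _+ℚ_ w 0ℚ ys ⟩
    weight w ys              ∎
    where open ≡-Reasoning

  weight-filterᵇ : (w : Fin k → ℚ) (p : Fin k → Bool) (xs : List (Fin k)) →
    weight w (filterᵇ p xs) ≡ weight (λ i → if p i then w i else 0ℚ) xs
  weight-filterᵇ w p [] = refl
  weight-filterᵇ w p (x ∷ xs) with ih ← weight-filterᵇ w p xs | p x
  ... | true  = cong (w x +ℚ_) ih
  ... | false = trans ih (sym (QP.+-identityˡ _))

  weight-map : {j : ℕ} (w : Fin k → ℚ) (f : Fin j → Fin k) (xs : List (Fin j)) →
    weight w (map f xs) ≡ weight (w ∘ f) xs
  weight-map w f = foldr-map (λ i acc → w i +ℚ acc) f 0ℚ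

weight-allFin-suc : {k : ℕ} (w : Fin (suc k) → ℚ) →
  weight w (allFin (suc k)) ≡ w zero +ℚ weight (w ∘ suc) (allFin k)
weight-allFin-suc {k} w = trans (cong (weight w) (allFin-suc k)) (cong (w zero +ℚ_) (weight-map w suc (allFin k)))

selectedWeight : {k : ℕ} → (Fin k → ℚ) → Subset k → ℚ
selectedWeight w [] = 0ℚ
selectedWeight w (b ∷ s) = (if b then w zero else 0ℚ) +ℚ selectedWeight (w ∘ suc) s

restrict : {k : ℕ} → Subset k → (Fin k → ℚ) → Fin k → ℚ
restrict s w i = if lookup s i then w i else 0ℚ

weight-members : {k : ℕ} (w : Fin k → ℚ) (s : Subset k) → weight w (members s) ≡ selectedWeight w s
weight-members w s = trans (weight-filterᵇ w (lookup s) (allFin _)) (weight-restrict-allFin w s)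
  where
  weight-restrict-allFin : {k : ℕ} (w : Fin k → ℚ) (s : Subset k) →
    weight (restrict s w) (allFin k) ≡ selectedWeight w s
  weight-restrict-allFin w [] = refl
  weight-restrict-allFin w (b ∷ s) =
    trans (weight-allFin-suc (restrict (b ∷ s) w))
          (cong ((if b then w zero else 0ℚ) +ℚ_) (weight-restrict-allFin (w ∘ suc) s))

selectedWeight-intersect : {k : ℕ} (w : Fin k → ℚ) (r s : Subset k) →
  selectedWeight w (intersect r s) ≡ selectedWeight (restrict s w) r
selectedWeight-intersect w [] [] = refl
selectedWeight-intersect w (true ∷ r) (b ∷ s) =
  cong ((if b then w zero else 0ℚ) +ℚ_) (selectedWeight-intersect (w ∘ suc) r s)
selectedWeight-intersect w (false ∷ r) (b ∷ s) = cong (0ℚ +ℚ_) (selectedWeight-intersect (w ∘ suc) r s)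

affineZeros≤half : {k : ℕ} (v : Fin k → ℚ) (i : Fin k) → isZero (v i) ≡ false → (c : ℚ) →
  count (λ s → isZero (c +ℚ selectedWeight v s)) (allSubsets k) * 2 ≤ 2 ^ k
affineZeros≤half {suc k} v zero v₀≠0 c = begin
  count Z (allSubsets (suc k)) * 2
    ≡⟨ cong (_* 2) (count-allSubsets-suc k Z) ⟩
  (count (Z ∘ (true ∷_)) (allSubsets k) + count (Z ∘ (false ∷_)) (allSubsets k)) * 2
    ≤⟨ *-monoˡ-≤ 2 (count-disjoint _ _ (λ s → atMostOneZero c (v zero) 0ℚ _ (isZero≡false⇒≢0 v₀≠0))
                                     (allSubsets k)) ⟩
  length (allSubsets k) * 2
    ≡⟨ cong (_* 2) (length-allSubsets k) ⟩
  2 ^ k * 2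
    ≡⟨ *-comm (2 ^ k) 2 ⟩
  2 ^ suc k ∎
  where
  open ≤-Reasoning
  Z : Subset (suc k) → Bool
  Z s = isZero (c +ℚ selectedWeight v s)
affineZeros≤half {suc k} v (suc i) vᵢ≠0 c = begin
  count Z (allSubsets (suc k)) * 2
    ≡⟨ cong (_* 2) (count-allSubsets-suc k Z) ⟩
  (count (Z ∘ (true ∷_)) (allSubsets k) + count (Z ∘ (false ∷_)) (allSubsets k)) * 2
    ≡⟨ *-distribʳ-+ 2 (count (Z ∘ (true ∷_)) (allSubsets k)) _ ⟩
  count (Z ∘ (true ∷_)) (allSubsets k) * 2 + count (Z ∘ (false ∷_)) (allSubsets k) * 2
    ≡⟨ cong₂ (λ x y → x * 2 + y * 2)
         (count-cong (λ s → cong isZero (sym (QP.+-assoc c (v zero) _))) (allSubsets k))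
         (count-cong (λ s → cong (λ t → isZero (c +ℚ t)) (QP.+-identityˡ _)) (allSubsets k)) ⟩
  count (Z′ (c +ℚ v zero)) (allSubsets k) * 2 + count (Z′ c) (allSubsets k) * 2
    ≤⟨ +-mono-≤ (affineZeros≤half (v ∘ suc) i vᵢ≠0 (c +ℚ v zero)) (affineZeros≤half (v ∘ suc) i vᵢ≠0 c) ⟩
  2 ^ k + 2 ^ k
    ≡⟨ cong (2 ^ k +_) (sym (+-identityʳ (2 ^ k))) ⟩
  2 ^ suc k ∎
  where
  open ≤-Reasoning
  Z : Subset (suc k) → Bool
  Z s = isZero (c +ℚ selectedWeight v s)
  Z′ : ℚ → Subset k → Bool
  Z′ d s = isZero (d +ℚ selectedWeight (v ∘ suc) s)

emptyRounds≤half : {k : ℕ} (w : Fin k → ℚ) (rem : Subset k) (i : Fin k) →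
  lookup rem i ≡ true → isZero (w i) ≡ false →
  count (λ r → isZero (weight w (members (intersect r rem)))) (allSubsets k) * 2 ≤ 2 ^ k
emptyRounds≤half {k} w rem i remᵢ wᵢ≠0 = begin
  count (λ r → isZero (weight w (members (intersect r rem)))) (allSubsets k) * 2
    ≡⟨ cong (_* 2) (count-cong as-affine (allSubsets k)) ⟩
  count (λ r → isZero (0ℚ +ℚ selectedWeight (restrict rem w) r)) (allSubsets k) * 2
    ≤⟨ affineZeros≤half (restrict rem w) i restrictᵢ≠0 0ℚ ⟩
  2 ^ k ∎
  where
  open ≤-Reasoning
  as-affine : ∀ r → isZero (weight w (members (intersect r rem))) ≡ isZero (0ℚ +ℚ selectedWeight (restrict rem w) r)
  as-affine r = cong isZero (trans (trans (weight-members w (intersect r rem)) (selectedWeight-intersect w r rem))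
                                   (sym (QP.+-identityˡ _)))
  restrictᵢ≠0 : isZero (restrict rem w i) ≡ false
  restrictᵢ≠0 rewrite remᵢ = wᵢ≠0

isLive : {k : ℕ} → (Fin k → ℚ) → Subset k → Fin k → Bool
isLive w rem i = lookup rem i ∧ not (isZero (w i))

counterfeitsIn : {k : ℕ} → (Fin k → ℚ) → Subset k → ℕ
counterfeitsIn {k} w rem = count (isLive w rem) (allFin k)

counterfeitsIn-full : {k : ℕ} (w : Fin k → ℚ) → counterfeitsIn w (replicate k true) ≡ numCounterfeit w
counterfeitsIn-full {k} w =
  count-cong (λ i → cong (λ b → b ∧ not (isZero (w i))) (lookup-replicate i true)) (allFin k)

counterfeitsIn-remove : {k : ℕ} (w : Fin k → ℚ) (rem : Subset k) (i : Fin k) →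
  lookup rem i ≡ true → isZero (w i) ≡ false →
  counterfeitsIn w rem ≡ suc (counterfeitsIn w (rem [ i ]≔ false))
counterfeitsIn-remove {suc k} w (true ∷ s) zero refl wᵢ≠0
  rewrite count-allFin-suc (isLive w (true ∷ s)) | count-allFin-suc (isLive w (false ∷ s)) | wᵢ≠0 = refl
counterfeitsIn-remove {suc k} w (b ∷ s) (suc i) sᵢ wᵢ≠0 = begin
  counterfeitsIn w (b ∷ s)
    ≡⟨ count-allFin-suc (isLive w (b ∷ s)) ⟩
  c₀ + counterfeitsIn (w ∘ suc) s
    ≡⟨ cong (c₀ +_) (counterfeitsIn-remove (w ∘ suc) s i sᵢ wᵢ≠0) ⟩
  c₀ + suc (counterfeitsIn (w ∘ suc) (s [ i ]≔ false))
    ≡⟨ +-suc c₀ _ ⟩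
  suc (c₀ + counterfeitsIn (w ∘ suc) (s [ i ]≔ false))
    ≡⟨ cong suc (sym (count-allFin-suc (isLive w (b ∷ (s [ i ]≔ false))))) ⟩
  suc (counterfeitsIn w (b ∷ (s [ i ]≔ false))) ∎
  where
  open ≡-Reasoning
  c₀ : ℕ
  c₀ = if b ∧ not (isZero (w zero)) then 1 else 0

liveCounterfeit : {k : ℕ} (w : Fin k → ℚ) (rem : Subset k) {d : ℕ} → counterfeitsIn w rem ≡ suc d →
  Σ (Fin k) λ i → lookup rem i ≡ true × isZero (w i) ≡ false
liveCounterfeit {k} w rem eq with count-suc⇒witness (isLive w rem) (allFin k) eq
... | i , liveᵢ with lookup rem i in remᵢ | isZero (w i) in wᵢ
...   | true | false = i , remᵢ , wᵢ

allFound≡and-not-live : {k : ℕ} (w : Fin k → ℚ) (rem : Subset k) →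
  allFound w rem ≡ and (map (not ∘ isLive w rem) (allFin k))
allFound≡and-not-live {k} w rem = cong and (map-cong deMorgan (allFin k))
  where
  deMorgan : ∀ i → isZero (w i) ∨ not (lookup rem i) ≡ not (isLive w rem i)
  deMorgan i with lookup rem i | isZero (w i)
  ... | true  | true  = refl
  ... | true  | false = refl
  ... | false | true  = refl
  ... | false | false = refl

noneLive⇒allFound : {k : ℕ} (w : Fin k → ℚ) (rem : Subset k) → counterfeitsIn w rem ≡ 0 → allFound w rem ≡ true
noneLive⇒allFound {k} w rem none = trans (allFound≡and-not-live w rem) (count≡0⇒and-not (isLive w rem) (allFin k) none)

someLive⇒¬allFound : {k : ℕ} (w : Fin k → ℚ) (rem : Subset k) {d : ℕ} → counterfeitsIn w rem ≡ suc d →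
  allFound w rem ≡ false
someLive⇒¬allFound {k} w rem some = trans (allFound≡and-not-live w rem) (count-suc⇒and-not (isLive w rem) (allFin k) some)

lookup-members : {k : ℕ} (s : Subset k) {i : Fin k} → i ∈ members s → lookup s i ≡ true
lookup-members {k} s i∈s = Equivalence.to T-≡ (proj₂ (∈-filter⁻ (T? ∘ lookup s) {xs = allFin k} i∈s))

length-members≤ : {k : ℕ} (s : Subset k) → length (members s) ≤ k
length-members≤ {k} s = ≤-trans (count≤length (lookup s) (allFin k)) (≤-reflexive (length-tabulate {n = k} id))

lookup-intersect : {k : ℕ} (r s : Subset k) (i : Fin k) → lookup (intersect r s) i ≡ true → lookup s i ≡ true
lookup-intersect (true ∷ r) (b ∷ s) zero eq = eq
lookup-intersect (a ∷ r) (b ∷ s) (suc i) eq = lookup-intersect r s i eq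

balancedPart : (a b : ℕ) → 2 ≤ a + b → a ≤ suc b → a < a + b × a ≤ ⌈ a + b /2⌉
balancedPart a zero 2≤a+0 a≤1 = ⊥-elim (<-irrefl refl (≤-trans 2≤a+0 (≤-trans (≤-reflexive (+-identityʳ a)) a≤1)))
balancedPart a (suc b) _ a≤2+b =
  m<m+n a z<s ,
  ≤-trans (≤-reflexive (n≡⌊n+n/2⌋ a)) (⌊n/2⌋-mono (≤-trans (+-monoʳ-≤ a a≤2+b) (≤-reflexive (+-suc a (suc b)))))

⌈log₂⌉-half : {a n : ℕ} → 2 ≤ n → a ≤ ⌈ n /2⌉ → suc ⌈log₂ a ⌉ ≤ ⌈log₂ n ⌉
⌈log₂⌉-half {a} {n} 2≤n a≤n/2 = begin
  suc ⌈log₂ a ⌉           ≤⟨ s≤s (⌈log₂⌉-mono-≤ a≤n/2) ⟩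
  suc ⌈log₂ ⌈ n /2⌉ ⌉     ≡⟨ cong suc (⌈log₂⌈n/2⌉⌉≡⌈log₂n⌉∸1 n) ⟩
  suc (⌈log₂ n ⌉ ∸ 1)     ≡⟨ +-comm 1 _ ⟩
  ⌈log₂ n ⌉ ∸ 1 + 1       ≡⟨ m∸n+n≡m (⌈log₂⌉-mono-≤ 2≤n) ⟩
  ⌈log₂ n ⌉               ∎
  where open ≤-Reasoning

module BinarySearch {k : ℕ} (sp : Splitter k) (valid : ValidSplitter sp) (w : Fin k → ℚ) where

  record Finds (fuel : ℕ) (l : List (Fin k)) : Set where
    constructor finds
    field
      coin        : Fin k
      queries     : ℕ
      result      : binSearch sp w fuel l ≡ just (coin , queries)
      coin∈l      : coin ∈ l
      counterfeit : isZero (w coin) ≡ false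
      queries≤log : queries ≤ ⌈log₂ length l ⌉

  halves-balanced : (l : List (Fin k)) → 2 ≤ length l →
    let (p₁ , p₂) = sp l in
    (length p₁ < length l × length p₁ ≤ ⌈ length l /2⌉) × (length p₂ < length l × length p₂ ≤ ⌈ length l /2⌉)
  halves-balanced l 2≤l with valid l 2≤l
  ... | perm , p₁≲p₂ , p₂≲p₁ =
    balanced lengths p₁≲p₂ , balanced (trans (+-comm (length (proj₂ (sp l))) _) lengths) p₂≲p₁
    where
    lengths : length (proj₁ (sp l)) + length (proj₂ (sp l)) ≡ length l
    lengths = trans (sym (length-++ (proj₁ (sp l)))) (↭-length perm)
    balanced : {a b : ℕ} → a + b ≡ length l → a ≤ suc b → a < length l × a ≤ ⌈ length l /2⌉
    balanced {a} {b} a+b≡l a≤1+b = subst (λ n → a < n × a ≤ ⌈ n /2⌉) a+b≡l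
      (balancedPart a b (≤-trans 2≤l (≤-reflexive (sym a+b≡l))) a≤1+b)

  finds-via-half : {f : ℕ} {l p : List (Fin k)} →
    2 ≤ length l → length p ≤ ⌈ length l /2⌉ → (∀ {i} → i ∈ p → i ∈ l) →
    (F : Finds f p) → binSearch sp w (suc f) l ≡ just (Finds.coin F , suc (Finds.queries F)) → Finds (suc f) l
  finds-via-half 2≤l p≤l/2 p⊆l (finds i q _ i∈p wᵢ≠0 q≤log) eq =
    finds i (suc q) eq (p⊆l i∈p) wᵢ≠0 (≤-trans (s≤s q≤log) (⌈log₂⌉-half 2≤l p≤l/2))

  binSearch-finds : (fuel : ℕ) (l : List (Fin k)) → length l ≤ fuel → isZero (weight w l) ≡ false → Finds fuel l
  binSearch-finds zero    []  _ ()
  binSearch-finds (suc f) []  _ ()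
  binSearch-finds (suc f) (x ∷ []) _ w≠0 =
    finds x 0 refl (here refl) (trans (cong isZero (sym (QP.+-identityʳ (w x)))) w≠0) z≤n
  binSearch-finds (suc f) l@(x ∷ y ∷ rest) (s≤s l≤f) wₗ≠0 = descend (isZero (weight w p₁)) refl
    where
    p₁ p₂ : List (Fin k)
    p₁ = proj₁ (sp l)
    p₂ = proj₂ (sp l)
    perm : (p₁ ++ p₂) ↭ l
    perm = proj₁ (valid l (s≤s (s≤s z≤n)))
    fuel : (p : List (Fin k)) → length p < length l → length p ≤ f
    fuel p p<l = ≤-pred (≤-trans p<l (s≤s l≤f))
    p₁<l : length p₁ < length l
    p₁<l = proj₁ (proj₁ (halves-balanced l (s≤s (s≤s z≤n))))
    p₁≤l/2 : length p₁ ≤ ⌈ length l /2⌉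
    p₁≤l/2 = proj₂ (proj₁ (halves-balanced l (s≤s (s≤s z≤n))))
    p₂<l : length p₂ < length l
    p₂<l = proj₁ (proj₂ (halves-balanced l (s≤s (s≤s z≤n))))
    p₂≤l/2 : length p₂ ≤ ⌈ length l /2⌉
    p₂≤l/2 = proj₂ (proj₂ (halves-balanced l (s≤s (s≤s z≤n))))
    descend : (z : Bool) → isZero (weight w p₁) ≡ z → Finds (suc f) l
    descend false w₁≠0 =
      finds-via-half (s≤s (s≤s z≤n)) p₁≤l/2 (λ i∈p → ∈-resp-↭ perm (∈-++⁺ˡ i∈p)) F (goes-left F)
      where
      F : Finds f p₁
      F = binSearch-finds f p₁ (fuel p₁ p₁<l) w₁≠0
      goes-left : (G : Finds f p₁) → binSearch sp w (suc f) l ≡ just (Finds.coin G , suc (Finds.queries G))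
      goes-left G rewrite Finds.result G | w₁≠0 = refl
    descend true w₁≡0 =
      finds-via-half (s≤s (s≤s z≤n)) p₂≤l/2 (λ i∈p → ∈-resp-↭ perm (∈-++⁺ʳ p₁ i∈p)) F (goes-right F)
      where
      w₂≡wₗ : weight w p₂ ≡ weight w l
      w₂≡wₗ = begin
        weight w p₂                     ≡⟨ sym (QP.+-identityˡ _) ⟩
        0ℚ +ℚ weight w p₂               ≡⟨ cong (_+ℚ weight w p₂) (sym (isZero⇒≡0 {weight w p₁} w₁≡0)) ⟩
        weight w p₁ +ℚ weight w p₂      ≡⟨ sym (weight-++ w p₁ p₂) ⟩
        weight w (p₁ ++ p₂)             ≡⟨ weight-↭ w perm ⟩
        weight w l                      ∎
        where open ≡-Reasoning
      F : Finds f p₂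
      F = binSearch-finds f p₂ (fuel p₂ p₂<l) (trans (cong isZero w₂≡wₗ) wₗ≠0)
      goes-right : (G : Finds f p₂) → binSearch sp w (suc f) l ≡ just (Finds.coin G , suc (Finds.queries G))
      goes-right G rewrite Finds.result G | w₁≡0 = refl

module RandomizedSearch {k : ℕ} (sp : Splitter k) (valid : ValidSplitter sp) (w : Fin k → ℚ)
                        (budget L : ℕ) (log≤L : ⌈log₂ k ⌉ ≤ L) where

  open BinarySearch sp valid w

  withinBudget : Maybe ℕ → Bool
  withinBudget nothing  = false
  withinBudget (just t) = t ≤ᵇ budget

  failuresFrom : (R : ℕ) → Subset k → ℕ → ℕ
  failuresFrom R rem q = count (λ rs → not (withinBudget (runRBS sp w rs rem q))) (allSeqs k R)

  Affordable : ℕ → Subset k → ℕ → Set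
  Affordable N rem q = q + N + counterfeitsIn w rem * L ≤ budget

  -- failure probability ≤ 2^d (3/4)^N, cleared of denominators
  FailureBound : ℕ → ℕ → Subset k → ℕ → Set
  FailureBound N R rem q = failuresFrom R rem q * 4 ^ N ≤ 2 ^ counterfeitsIn w rem * 3 ^ N * 2 ^ (k * R)

  run-done : {R : ℕ} (rs : Vec (Subset k) R) {rem : Subset k} {q : ℕ} → allFound w rem ≡ true →
    runRBS sp w rs rem q ≡ just q
  run-done rs found rewrite found = refl

  run-miss : {R : ℕ} (r : Subset k) (rs : Vec (Subset k) R) {rem : Subset k} {q : ℕ} → allFound w rem ≡ false →
    isZero (weight w (members (intersect r rem))) ≡ true → runRBS sp w (r ∷ rs) rem q ≡ runRBS sp w rs rem (suc q)
  run-miss r rs {rem} {q} = go rem refl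
    where
    -- rem′ stands apart from rem so that rewriting with the hypotheses leaves the
    -- right-hand side, which starts with the same test, untouched.
    go : ∀ rem′ → rem′ ≡ rem → allFound w rem′ ≡ false →
      isZero (weight w (members (intersect r rem′))) ≡ true →
      runRBS sp w (r ∷ rs) rem′ q ≡ runRBS sp w rs rem (suc q)
    go rem′ rem′≡rem ¬found miss rewrite ¬found | miss = cong (λ t → runRBS sp w rs t (suc q)) rem′≡rem

  run-hit : {R : ℕ} (r : Subset k) (rs : Vec (Subset k) R) {rem : Subset k} {q : ℕ} {i : Fin k} {q′ : ℕ} →
    allFound w rem ≡ false → isZero (weight w (members (intersect r rem))) ≡ false →
    binSearch sp w (length (members (intersect r rem))) (members (intersect r rem)) ≡ just (i , q′) →
    runRBS sp w (r ∷ rs) rem q ≡ runRBS sp w rs (rem [ i ]≔ false) (suc (q + q′))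
  run-hit r rs {rem} {q} {i} {q′} = go rem refl
    where
    go : ∀ rem′ → rem′ ≡ rem → allFound w rem′ ≡ false →
      isZero (weight w (members (intersect r rem′))) ≡ false →
      binSearch sp w (length (members (intersect r rem′))) (members (intersect r rem′)) ≡ just (i , q′) →
      runRBS sp w (r ∷ rs) rem′ q ≡ runRBS sp w rs (rem [ i ]≔ false) (suc (q + q′))
    go rem′ rem′≡rem ¬found hit search rewrite ¬found | hit | search =
      cong (λ t → runRBS sp w rs (t [ i ]≔ false) (suc (q + q′))) rem′≡rem

  failuresFrom-done : {R : ℕ} {rem : Subset k} {q : ℕ} → allFound w rem ≡ true → q ≤ budget → failuresFrom R rem q ≡ 0
  failuresFrom-done {R} {rem} {q} found q≤budget =
    trans (count-cong (λ rs → cong (not ∘ withinBudget) (run-done rs found)) (allSeqs k R))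
          (trans (count-cong (λ _ → cong not (Equivalence.to T-≡ (≤⇒≤ᵇ q≤budget))) (allSeqs k R))
                 (count-false (allSeqs k R)))

  failureBound-trivial : (R : ℕ) (rem : Subset k) (q : ℕ) → FailureBound 0 R rem q
  failureBound-trivial R rem q = begin
    failuresFrom R rem q * 1                    ≡⟨ *-identityʳ _ ⟩
    failuresFrom R rem q                        ≤⟨ count≤length _ (allSeqs k R) ⟩
    length (allSeqs k R)                        ≡⟨ length-allSeqs k R ⟩
    2 ^ (k * R)
      ≤⟨ m≤n*m (2 ^ (k * R)) (2 ^ counterfeitsIn w rem) {{m^n≢0 2 (counterfeitsIn w rem)}} ⟩
    2 ^ counterfeitsIn w rem * 2 ^ (k * R)      ≡⟨ cong (_* 2 ^ (k * R)) (sym (*-identityʳ (2 ^ counterfeitsIn w rem))) ⟩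
    2 ^ counterfeitsIn w rem * 1 * 2 ^ (k * R)  ∎
    where open ≤-Reasoning

  affordable-miss : {N : ℕ} {rem : Subset k} {q : ℕ} → Affordable (suc N) rem q → Affordable N rem (suc q)
  affordable-miss {N} {rem} {q} = ≤-trans (≤-reflexive (cong (_+ counterfeitsIn w rem * L) (sym (+-suc q N))))

  affordable-hit : (q q′ N D : ℕ) → q′ ≤ L → suc (q + q′) + N + D * L ≤ q + suc N + suc D * L
  affordable-hit q q′ N D q′≤L = begin
    suc (q + q′) + N + D * L      ≡⟨ reorder q q′ N D L ⟩
    q + suc N + D * L + q′        ≤⟨ +-monoʳ-≤ (q + suc N + D * L) q′≤L ⟩
    q + suc N + D * L + L         ≡⟨ collect q N D L ⟩
    q + suc N + suc D * L         ∎
    where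
    open ≤-Reasoning
    reorder : ∀ q q′ N D L → suc (q + q′) + N + D * L ≡ q + suc N + D * L + q′
    reorder = solve-∀
    collect : ∀ q N D L → q + suc N + D * L + L ≡ q + suc N + suc D * L
    collect = solve-∀

  afterRound : ℕ → Subset k → ℕ → Subset k → ℕ
  afterRound R rem q r = count (λ rs → not (withinBudget (runRBS sp w (r ∷ rs) rem q))) (allSeqs k R)

  isMiss : Subset k → Subset k → Bool
  isMiss rem r = isZero (weight w (members (intersect r rem)))

  Bounded : ℕ → ℕ → Set
  Bounded N R = ∀ rem q → Affordable N rem q → FailureBound N R rem q

  module _ (N R : ℕ) (rem : Subset k) (q D : ℕ) (d≡1+D : counterfeitsIn w rem ≡ suc D)
           (affordable : Affordable (suc N) rem q) (IH : Bounded N R) where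

    X : ℕ
    X = 2 ^ D * 3 ^ N * 2 ^ (k * R)

    ¬found : allFound w rem ≡ false
    ¬found = someLive⇒¬allFound w rem d≡1+D

    afterMiss≤ : (r : Subset k) → isMiss rem r ≡ true → afterRound R rem q r * 4 ^ N ≤ 2 * X
    afterMiss≤ r miss = begin
      afterRound R rem q r * 4 ^ N
        ≡⟨ cong (_* 4 ^ N) (count-cong (λ rs → cong (not ∘ withinBudget) (run-miss r rs ¬found miss)) (allSeqs k R)) ⟩
      failuresFrom R rem (suc q) * 4 ^ N
        ≤⟨ IH rem (suc q) (affordable-miss {N} {rem} affordable) ⟩
      2 ^ counterfeitsIn w rem * 3 ^ N * 2 ^ (k * R)
        ≡⟨ cong (λ d → 2 ^ d * 3 ^ N * 2 ^ (k * R)) d≡1+D ⟩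
      2 * 2 ^ D * 3 ^ N * 2 ^ (k * R)
        ≡⟨ reassociate (2 ^ D) (3 ^ N) (2 ^ (k * R)) ⟩
      2 * X ∎
      where
      open ≤-Reasoning
      reassociate : ∀ a b c → 2 * a * b * c ≡ 2 * (a * b * c)
      reassociate = solve-∀

    afterHit≤ : (r : Subset k) → isMiss rem r ≡ false → afterRound R rem q r * 4 ^ N ≤ X
    afterHit≤ r hit
      with finds i q′ search i∈A′ wᵢ≠0 q′≤log ← binSearch-finds _ (members (intersect r rem)) ≤-refl hit = begin
      afterRound R rem q r * 4 ^ N
        ≡⟨ cong (_* 4 ^ N)
             (count-cong (λ rs → cong (not ∘ withinBudget) (run-hit r rs ¬found hit search)) (allSeqs k R)) ⟩
      failuresFrom R rem′ (suc (q + q′)) * 4 ^ N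
        ≤⟨ IH rem′ (suc (q + q′)) affordable′ ⟩
      2 ^ counterfeitsIn w rem′ * 3 ^ N * 2 ^ (k * R)
        ≡⟨ cong (λ d → 2 ^ d * 3 ^ N * 2 ^ (k * R)) (suc-injective (trans (sym removed) d≡1+D)) ⟩
      X ∎
      where
      open ≤-Reasoning
      rem′ : Subset k
      rem′ = rem [ i ]≔ false
      removed : counterfeitsIn w rem ≡ suc (counterfeitsIn w rem′)
      removed = counterfeitsIn-remove w rem i (lookup-intersect r rem i (lookup-members (intersect r rem) i∈A′)) wᵢ≠0
      q′≤L : q′ ≤ L
      q′≤L = ≤-trans q′≤log (≤-trans (⌈log₂⌉-mono-≤ (length-members≤ (intersect r rem))) log≤L)
      affordable′ : Affordable N rem′ (suc (q + q′))
      affordable′ = ≤-trans (affordable-hit q q′ N (counterfeitsIn w rem′) q′≤L)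
                            (subst (λ d → q + suc N + d * L ≤ budget) removed affordable)

    afterRound≤ : (r : Subset k) → afterRound R rem q r * 4 ^ N ≤ (if isMiss rem r then 2 * X else X)
    afterRound≤ r with isMiss rem r in miss
    ... | true  = afterMiss≤ r miss
    ... | false = afterHit≤ r miss

    oneRound : FailureBound (suc N) (suc R) rem q
    oneRound = begin
      failuresFrom (suc R) rem q * 4 ^ suc N
        ≡⟨ cong (_* 4 ^ suc N) (count-allSeqs-suc k R _) ⟩
      sum (map (afterRound R rem q) (allSubsets k)) * (4 * 4 ^ N)
        ≡⟨ regroup (sum (map (afterRound R rem q) (allSubsets k))) (4 ^ N) ⟩
      2 * (2 * (sum (map (afterRound R rem q) (allSubsets k)) * 4 ^ N))
        ≤⟨ *-monoʳ-≤ 2 (averaging (afterRound R rem q) (isMiss rem) afterRound≤ (allSubsets k) fewMisses) ⟩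
      2 * (3 * (X * length (allSubsets k)))
        ≡⟨ cong (λ n → 2 * (3 * (X * n))) (length-allSubsets k) ⟩
      2 * (3 * (2 ^ D * 3 ^ N * 2 ^ (k * R) * 2 ^ k))
        ≡⟨ collect (2 ^ D) (3 ^ N) (2 ^ k) (2 ^ (k * R)) ⟩
      2 ^ suc D * 3 ^ suc N * (2 ^ k * 2 ^ (k * R))
        ≡⟨ cong₂ (λ d e → 2 ^ d * 3 ^ suc N * e) (sym d≡1+D)
                 (sym (trans (cong (2 ^_) (*-suc k R)) (^-distribˡ-+-* 2 k (k * R)))) ⟩
      2 ^ counterfeitsIn w rem * 3 ^ suc N * 2 ^ (k * suc R) ∎
      where
      open ≤-Reasoning
      fewMisses : count (isMiss rem) (allSubsets k) * 2 ≤ length (allSubsets k)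
      fewMisses with i , remᵢ , wᵢ≠0 ← liveCounterfeit w rem d≡1+D =
        ≤-trans (emptyRounds≤half w rem i remᵢ wᵢ≠0) (≤-reflexive (sym (length-allSubsets k)))
      regroup : ∀ S c → S * (4 * c) ≡ 2 * (2 * (S * c))
      regroup = solve-∀
      collect : ∀ a b c e → 2 * (3 * (a * b * e * c)) ≡ 2 * a * (3 * b) * (c * e)
      collect = solve-∀

  failureBound : (N R : ℕ) → N ≤ R → Bounded N R
  failureBound zero R _ rem q _ = failureBound-trivial R rem q
  failureBound (suc N) (suc R) (s≤s N≤R) rem q affordable = byLiveCount (counterfeitsIn w rem) refl
    where
    byLiveCount : (d : ℕ) → counterfeitsIn w rem ≡ d → FailureBound (suc N) (suc R) rem q
    byLiveCount zero none =
      ≤-trans (≤-reflexive (cong (_* 4 ^ suc N) (failuresFrom-done {suc R} {rem} (noneLive⇒allFound w rem none) q≤budget)))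
              z≤n
      where
      q≤budget : q ≤ budget
      q≤budget = ≤-trans (≤-trans (m≤m+n q (suc N)) (m≤m+n (q + suc N) _)) affordable
    byLiveCount (suc D) some = oneRound N R rem q D some affordable (failureBound N R N≤R)

  failures≡failuresFrom : failures sp w budget ≡ failuresFrom budget (replicate k true) 0
  failures≡failuresFrom = count-cong (λ rs → cong not (succeeds≡ rs)) (allSeqs k budget)
    where
    succeeds≡ : (rs : Vec (Subset k) budget) → succeeds sp w budget rs ≡ withinBudget (runRBS sp w rs (replicate k true) 0)
    succeeds≡ rs with runRBS sp w rs (replicate k true) 0
    ... | nothing = refl
    ... | just t  = refl

  failures≤ : (m : ℕ) → numCounterfeit w ≤ m → 3 * m + m * L ≤ budget →
    failures sp w budget * 64 ^ m ≤ 54 ^ m * 2 ^ (k * budget)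
  failures≤ m few fits = begin
    failures sp w budget * 64 ^ m
      ≡⟨ cong₂ _*_ failures≡failuresFrom (^-*-assoc 4 3 m) ⟩
    failuresFrom budget all 0 * 4 ^ (3 * m)
      ≤⟨ failureBound (3 * m) budget (≤-trans (m≤m+n (3 * m) _) fits) all 0 affordable ⟩
    2 ^ counterfeitsIn w all * 3 ^ (3 * m) * 2 ^ (k * budget)
      ≤⟨ *-monoˡ-≤ (2 ^ (k * budget)) (*-monoˡ-≤ (3 ^ (3 * m)) (^-monoʳ-≤ 2 d≤m)) ⟩
    2 ^ m * 3 ^ (3 * m) * 2 ^ (k * budget)
      ≡⟨ cong (_* 2 ^ (k * budget)) (trans (cong (2 ^ m *_) (sym (^-*-assoc 3 3 m))) (sym (^-distrib-* 2 27 m))) ⟩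
    54 ^ m * 2 ^ (k * budget) ∎
    where
    open ≤-Reasoning
    all : Subset k
    all = replicate k true
    d≤m : counterfeitsIn w all ≤ m
    d≤m = ≤-trans (≤-reflexive (counterfeitsIn-full w)) few
    affordable : Affordable (3 * m) all 0
    affordable = ≤-trans (+-monoʳ-≤ (3 * m) (*-monoˡ-≤ L d≤m)) fits

lemma3p1 : Σ ℕ λ a → Σ ℕ λ b → Σ ℕ λ m₀ → a < b ×
    ((n m k : ℕ) → 1 ≤ m → m ≤ n → m₀ ≤ m → k ≤ n →
     (w : Fin k → ℚ) → numCounterfeit w ≤ m →
     (sp : Splitter k) → ValidSplitter sp →
     failures sp w ((⌈log₂ n ⌉ + 3) * m) * b ^ m
       ≤ a ^ m * 2 ^ (k * ((⌈log₂ n ⌉ + 3) * m)))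
lemma3p1 = 54 , 64 , 0 , m<m+n 54 {10} z<s , λ n m k _ _ _ k≤n w few sp valid →
  RandomizedSearch.failures≤ sp valid w ((⌈log₂ n ⌉ + 3) * m) ⌈log₂ n ⌉ (⌈log₂⌉-mono-≤ k≤n)
    m few (≤-reflexive (budget≡ m ⌈log₂ n ⌉))
  where
  budget≡ : ∀ m L → 3 * m + m * L ≡ (L + 3) * m
  budget≡ = solve-∀
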